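{- The relation of definitional mergeability between first-order theories is not transitive; hence it is not an equivalence relation. That is, there exist theories $T_1,T_2,T_3$ such that $T_1$ and $T_3$ are definitionally mergeable and $T_3$ and $T_2$ are definitionally mergeable, but $T_1$ and $T_2$ are not definitionally mergeable.
   Context: All first-order languages considered contain only relation symbols (no function or constant symbols) and equality. A signature is a set of relation symbols; a theory is a set of sentences over a signature; $Mod(T)$ is the class of models of $T$. Two theories are logically equivalent, $T\equiv T'$, if they have the same class of models. If $\mathcal{L}\subseteq\mathcal{L}^+$ are languages, an explicit definition of an $n$-ary relation symbol $p\in\mathcal{L}^+\setminus\mathcal{L}$ in terms of $\mathcal{L}$ is a sentence $\forall x_1\ldots\forall x_n[p(x_1,\ldots,x_n)\leftrightarrow\varphi(x_1,\ldots,x_n)]$ with $\varphi$ a formula of $\mathcal{L}$. A theory $T^+$ of language $\mathcal{L}^+$ is a definitional extension of a theory $T$ of language $\mathcal{L}\subseteq\mathcal{L}^+$ if $T^+\equiv T\cup\Delta$, where $\Delta$ consists of one explicit definition in terms of $\mathcal{L}$ for each relation symbol of $\mathcal{L}^+\setminus\mathcal{L}$. Theories $T_1,T_2$ (whose signatures may overlap) are definitionally mergeable if there is a theory $T^+$ which is a definitional extension of both $T_1$ and $T_2$. -}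

module Defs where

open import Data.Nat using (ℕ; _<_; _≟_)
open import Data.Product using (Σ; _×_; _,_; proj₁; proj₂)
open import Data.Vec using (Vec; map; tabulate)
open import Data.Fin using (toℕ)
open import Data.List using (List; foldr; upTo)
open import Data.Unit using (⊤)
open import Data.Empty using (⊥)
open import Relation.Nullary using (¬_; yes; no)
open import Relation.Binary.PropositionalEquality using (_≡_)

-- Relation symbols: a global supply of symbols, each a pair
-- (name , arity).  Signatures are sets of symbols (so they may overlap).

Sym : Set
Sym = ℕ × ℕ

arity : Sym → ℕ
arity = proj₂

Signature : Set₁
Signature = Sym → Set

_⊆ˢ_ : Signature → Signature → Set
L ⊆ˢ L' = ∀ s → L s → L' s

data Formula : Set where
  rel  : (s : Sym) → Vec ℕ (arity s) → Formula
  eq   : ℕ → ℕ → Formula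
  neg  : Formula → Formula
  conj : Formula → Formula → Formula
  all  : ℕ → Formula → Formula

imp : Formula → Formula → Formula
imp φ ψ = neg (conj φ (neg ψ))

iff : Formula → Formula → Formula
iff φ ψ = conj (imp φ ψ) (imp ψ φ)

data _∈ᵛ_ (x : ℕ) : ∀ {n} → Vec ℕ n → Set where
  here  : ∀ {n} {xs : Vec ℕ n} → x ∈ᵛ (x Data.Vec.∷ xs)
  there : ∀ {n y} {xs : Vec ℕ n} → x ∈ᵛ xs → x ∈ᵛ (y Data.Vec.∷ xs)

data Free (x : ℕ) : Formula → Set where
  f-rel  : ∀ {s xs} → x ∈ᵛ xs → Free x (rel s xs)
  f-eqˡ  : ∀ {y} → Free x (eq x y)
  f-eqʳ  : ∀ {y} → Free x (eq y x)
  f-neg  : ∀ {φ} → Free x φ → Free x (neg φ)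
  f-conjˡ : ∀ {φ ψ} → Free x φ → Free x (conj φ ψ)
  f-conjʳ : ∀ {φ ψ} → Free x ψ → Free x (conj φ ψ)
  f-all  : ∀ {y φ} → ¬ (x ≡ y) → Free x φ → Free x (all y φ)

Sentence : Formula → Set
Sentence φ = ∀ x → ¬ Free x φ

Uses : Signature → Formula → Set
Uses L (rel s xs)   = L s
Uses L (eq x y)     = ⊤
Uses L (neg φ)      = Uses L φ
Uses L (conj φ ψ)   = Uses L φ × Uses L ψ
Uses L (all x φ)    = Uses L φ

-- Structures (nonempty carrier; every symbol interpreted — only the
-- symbols of the relevant signature matter for satisfaction).

record Structure : Set₁ where
  field
    Carrier : Set
    point   : Carrier
    interp  : (s : Sym) → Vec Carrier (arity s) → Set
open Structure public

update : {A : Set} → (ℕ → A) → ℕ → A → ℕ → A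
update ρ x a y with y ≟ x
... | yes _ = a
... | no  _ = ρ y

-- Classical (Tarskian) satisfaction, via double negation on atoms so
-- that every satisfaction statement is ¬¬-stable.
Sat : (M : Structure) → (ℕ → Carrier M) → Formula → Set
Sat M ρ (rel s xs)  = ¬ ¬ interp M s (map ρ xs)
Sat M ρ (eq x y)    = ¬ ¬ (ρ x ≡ ρ y)
Sat M ρ (neg φ)     = ¬ Sat M ρ φ
Sat M ρ (conj φ ψ)  = Sat M ρ φ × Sat M ρ ψ
Sat M ρ (all x φ)   = ∀ a → Sat M (update ρ x a) φ

_⊨_ : Structure → Formula → Set
M ⊨ φ = Sat M (λ _ → point M) φ

record Theory : Set₁ where
  field
    sig : Signature
    ax  : Formula → Set
    wf  : ∀ φ → ax φ → Sentence φ × Uses sig φ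
open Theory public

_⊨ᵀ_ : Structure → Theory → Set
M ⊨ᵀ T = ∀ φ → ax T φ → M ⊨ φ

explicitDef : (p : Sym) → Formula → Formula
explicitDef p φ =
  foldr all (iff (rel p (tabulate toℕ)) φ) (upTo (arity p))

DefiningFormula : Signature → Sym → Formula → Set
DefiningFormula L p φ = Uses L φ × (∀ x → Free x φ → x < arity p)

-- T⁺ is a definitional extension of T:
--   L ⊆ L⁺ and T⁺ ≡ T ∪ Δ, where Δ contains one explicit definition
--   (in terms of L) for each symbol of L⁺ ∖ L.
-- Logical equivalence = same models (among L⁺-structures).
DefExt : Theory → Theory → Set₁
DefExt T⁺ T =
  (sig T ⊆ˢ sig T⁺) ×
  Σ (Sym → Formula) λ d →
    (∀ p → sig T⁺ p → ¬ sig T p → DefiningFormula (sig T) p (d p)) ×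
    (∀ (M : Structure) →
       (M ⊨ᵀ T⁺ → (M ⊨ᵀ T) × (∀ p → sig T⁺ p → ¬ sig T p → M ⊨ explicitDef p (d p)))
     × ((M ⊨ᵀ T) × (∀ p → sig T⁺ p → ¬ sig T p → M ⊨ explicitDef p (d p)) → M ⊨ᵀ T⁺))

DefMergeable : Theory → Theory → Set₁
DefMergeable T₁ T₂ = Σ Theory λ T⁺ → DefExt T⁺ T₁ × DefExt T⁺ T₂

-- Every model of T expands to a model of a definitional extension T⁺ of T, by interpreting each
-- new symbol through its defining formula; the old symbols keep their meaning.  So if T₁ and T₂
-- are definitionally mergeable and sig T₂ ⊆ sig T₁, every model of T₁ is a model of T₂.  This
-- separates T₁ = {∀x P x} from T₂ = {∀x ¬P x}, while both merge with T₃ = {∀x Q x}: in the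
-- merged theories Q is defined by ⊤, and P by ⊤ or ⊥ respectively.

module Submission where

open import Defs
open import Data.Bool using (Bool; true; false)
open import Data.Fin using (toℕ; fromℕ<)
open import Data.Fin.Properties using (toℕ-fromℕ<)
open import Data.List using ([]; _∷_; foldr; upTo)
open import Data.Nat using (ℕ; zero; suc; _<_; _≟_; z≤n; s≤s)
open import Data.Product using (Σ; _×_; _,_; proj₁; proj₂; map₂)
open import Data.Product.Function.NonDependent.Propositional using (_×-⇔_)
open import Data.Sum using (_⊎_; inj₁; inj₂; swap)
open import Data.Unit using (⊤; tt)
open import Data.Vec using (Vec; []; _∷_; lookup; map; tabulate)
open import Data.Vec.Properties using (lookup-map; lookup∘tabulate)
open import Function using (id; _∘_; _⇔_; mk⇔; Equivalence)
open import Function.Properties.Equivalence using (⇔-setoid)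
open import Function.Construct.Composition using (_⇔-∘_)
open import Function.Related.TypeIsomorphisms using (¬-cong-⇔)
open import Level using (0ℓ)
open import Relation.Binary.PropositionalEquality using (_≡_; refl; sym; cong; cong₂; module ≡-Reasoning)
open import Relation.Nullary using (¬_; yes; no)
open import Relation.Nullary.Negation using (negated-stable; contradiction)
open import Relation.Binary.Bundles using (Setoid)
import Relation.Binary.Reasoning.Setoid as SetoidReasoning

open Equivalence using (to; from)
open Setoid (⇔-setoid 0ℓ) using () renaming (reflexive to ≡⇒⇔; refl to ⇔-refl; sym to ⇔-sym)

Sat-stable : ∀ M ρ φ → ¬ ¬ Sat M ρ φ → Sat M ρ φ
Sat-stable M ρ (rel s xs) = negated-stable
Sat-stable M ρ (eq x y)   = negated-stable
Sat-stable M ρ (neg φ)    = negated-stable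
Sat-stable M ρ (conj φ ψ) h =
  Sat-stable M ρ φ (λ k → h (k ∘ proj₁)) , Sat-stable M ρ ψ (λ k → h (k ∘ proj₂))
Sat-stable M ρ (all x φ) h a = Sat-stable M (update ρ x a) φ (λ k → h (λ f → k (f a)))

Sat-iff : ∀ M ρ φ ψ → Sat M ρ (iff φ ψ) ⇔ (Sat M ρ φ ⇔ Sat M ρ ψ)
Sat-iff M ρ φ ψ = mk⇔
  (λ (φ⇒ψ , ψ⇒φ) → mk⇔ (λ s → Sat-stable M ρ ψ (λ k → φ⇒ψ (s , k)))
                       (λ s → Sat-stable M ρ φ (λ k → ψ⇒φ (s , k))))
  (λ φ⇔ψ → (λ (s , k) → k (to φ⇔ψ s)) , (λ (s , k) → k (from φ⇔ψ s)))

Sat-foldr-all : ∀ M φ xs → (∀ ρ → Sat M ρ φ) → ∀ ρ → Sat M ρ (foldr all φ xs)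
Sat-foldr-all M φ []       h ρ   = h ρ
Sat-foldr-all M φ (x ∷ xs) h ρ a = Sat-foldr-all M φ xs h (update ρ x a)

Uses-mono : ∀ {L L'} → L ⊆ˢ L' → ∀ φ → Uses L φ → Uses L' φ
Uses-mono L⊆L' (rel s xs) u       = L⊆L' s u
Uses-mono L⊆L' (eq x y)   u       = u
Uses-mono L⊆L' (neg φ)    u       = Uses-mono L⊆L' φ u
Uses-mono L⊆L' (conj φ ψ) (u , v) = Uses-mono L⊆L' φ u , Uses-mono L⊆L' ψ v
Uses-mono L⊆L' (all x φ)  u       = Uses-mono L⊆L' φ u

map-cong-∈ᵛ : ∀ {A : Set} {n} (ρ σ : ℕ → A) (xs : Vec ℕ n) →
              (∀ x → x ∈ᵛ xs → ρ x ≡ σ x) → map ρ xs ≡ map σ xs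
map-cong-∈ᵛ ρ σ []       h = refl
map-cong-∈ᵛ ρ σ (x ∷ xs) h = cong₂ _∷_ (h x here) (map-cong-∈ᵛ ρ σ xs (λ y → h y ∘ there))

update-cong-Free : ∀ {A : Set} (ρ σ : ℕ → A) y a φ →
                   (∀ x → Free x (all y φ) → ρ x ≡ σ x) →
                   ∀ x → Free x φ → update ρ y a x ≡ update σ y a x
update-cong-Free ρ σ y a φ h x x∈φ with x ≟ y
... | yes _  = refl
... | no x≢y = h x (f-all x≢y x∈φ)

Π-cong-⇔ : {A : Set} {P Q : A → Set} → (∀ a → P a ⇔ Q a) → (∀ a → P a) ⇔ (∀ a → Q a)
Π-cong-⇔ P⇔Q = mk⇔ (λ p a → to (P⇔Q a) (p a)) (λ q a → from (P⇔Q a) (q a))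

Sat-coincidence : ∀ M (ρ σ : ℕ → Carrier M) φ → (∀ x → Free x φ → ρ x ≡ σ x) →
                  Sat M ρ φ ⇔ Sat M σ φ
Sat-coincidence M ρ σ (rel s xs) h =
  ≡⇒⇔ (cong (λ v → ¬ ¬ interp M s v) (map-cong-∈ᵛ ρ σ xs (λ x → h x ∘ f-rel)))
Sat-coincidence M ρ σ (eq x y) h =
  ≡⇒⇔ (cong (¬_ ∘ ¬_) (cong₂ _≡_ (h x f-eqˡ) (h y f-eqʳ)))
Sat-coincidence M ρ σ (neg φ) h = ¬-cong-⇔ (Sat-coincidence M ρ σ φ (λ x → h x ∘ f-neg))
Sat-coincidence M ρ σ (conj φ ψ) h =
  Sat-coincidence M ρ σ φ (λ x → h x ∘ f-conjˡ) ×-⇔ Sat-coincidence M ρ σ ψ (λ x → h x ∘ f-conjʳ)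
Sat-coincidence M ρ σ (all y φ) h = Π-cong-⇔ λ a →
  Sat-coincidence M (update ρ y a) (update σ y a) φ (update-cong-Free ρ σ y a φ h)

reinterpret : (M : Structure) → ((s : Sym) → Vec (Carrier M) (arity s) → Set) → Structure
reinterpret M I = record { Carrier = Carrier M ; point = point M ; interp = I }

Sat-reinterpret : ∀ M I L → (∀ s → L s → ∀ xs → interp M s xs ⇔ I s xs) →
                  ∀ ρ φ → Uses L φ → Sat M ρ φ ⇔ Sat (reinterpret M I) ρ φ
Sat-reinterpret M I L M≈I ρ (rel s xs) s∈L = ¬-cong-⇔ (¬-cong-⇔ (M≈I s s∈L (map ρ xs)))
Sat-reinterpret M I L M≈I ρ (eq x y)   _   = ⇔-refl
Sat-reinterpret M I L M≈I ρ (neg φ)    u   = ¬-cong-⇔ (Sat-reinterpret M I L M≈I ρ φ u)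
Sat-reinterpret M I L M≈I ρ (conj φ ψ) (u , v) =
  Sat-reinterpret M I L M≈I ρ φ u ×-⇔ Sat-reinterpret M I L M≈I ρ ψ v
Sat-reinterpret M I L M≈I ρ (all x φ)  u   =
  Π-cong-⇔ λ a → Sat-reinterpret M I L M≈I (update ρ x a) φ u

vecAssignment : {A : Set} → A → ∀ {n} → Vec A n → ℕ → A
vecAssignment a []       i       = a
vecAssignment a (x ∷ xs) zero    = x
vecAssignment a (x ∷ xs) (suc i) = vecAssignment a xs i

vecAssignment-lookup : ∀ {A : Set} (a : A) {n} (xs : Vec A n) {i} (i<n : i < n) →
                       vecAssignment a xs i ≡ lookup xs (fromℕ< i<n)
vecAssignment-lookup a (x ∷ xs) {zero}  (s≤s z≤n) = refl
vecAssignment-lookup a (x ∷ xs) {suc i} (s≤s i<n) = vecAssignment-lookup a xs i<n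

vecAssignment-tabulate : ∀ {A : Set} (a : A) (ρ : ℕ → A) {n i} → i < n →
                         vecAssignment a (map ρ (tabulate {n = n} toℕ)) i ≡ ρ i
vecAssignment-tabulate a ρ {n} {i} i<n = begin
  vecAssignment a (map ρ indices) i   ≡⟨ vecAssignment-lookup a (map ρ indices) i<n ⟩
  lookup (map ρ indices) (fromℕ< i<n) ≡⟨ lookup-map (fromℕ< i<n) ρ indices ⟩
  ρ (lookup indices (fromℕ< i<n))     ≡⟨ cong ρ (lookup∘tabulate toℕ (fromℕ< i<n)) ⟩
  ρ (toℕ (fromℕ< i<n))                ≡⟨ cong ρ (toℕ-fromℕ< i<n) ⟩
  ρ i                                 ∎
  where
  open ≡-Reasoning
  indices = tabulate {n = n} toℕ

module Expansion (L : Signature) (d : Sym → Formula) (M : Structure) where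

  -- Phrasing both cases as implications avoids having to decide membership in L.
  expansion : Structure
  expansion = reinterpret M λ p xs →
    (L p → interp M p xs) × (¬ L p → Sat M (vecAssignment (point M) xs) (d p))

  expansion-agrees : ∀ ρ φ → Uses L φ → Sat M ρ φ ⇔ Sat expansion ρ φ
  expansion-agrees = Sat-reinterpret M _ L λ p p∈L xs →
    mk⇔ (λ i → (λ _ → i) , contradiction p∈L) (λ (i , _) → i p∈L)

  expansion-defines : ∀ p → DefiningFormula L p (d p) → ¬ L p → expansion ⊨ explicitDef p (d p)
  expansion-defines p (d-uses , d-bound) p∉L =
    Sat-foldr-all expansion _ (upTo (arity p))
      (λ ρ → from (Sat-iff expansion ρ (rel p (tabulate toℕ)) (d p)) (defines ρ)) _
    where
    open SetoidReasoning (⇔-setoid 0ℓ)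
    defines : ∀ ρ → Sat expansion ρ (rel p (tabulate toℕ)) ⇔ Sat expansion ρ (d p)
    defines ρ = begin
      Sat expansion ρ (rel p (tabulate toℕ))
        ≈⟨ mk⇔ (λ h → Sat-stable M _ (d p) (λ k → h (λ (_ , s) → k (s p∉L))))
               (λ s k → k ((λ p∈L → contradiction p∈L p∉L) , λ _ → s)) ⟩
      Sat M (vecAssignment (point M) (map ρ (tabulate {n = arity p} toℕ))) (d p)
        ≈⟨ Sat-coincidence M _ ρ (d p) (λ x x∈d →
             vecAssignment-tabulate (point M) ρ {arity p} (d-bound x x∈d)) ⟩
      Sat M ρ (d p)
        ≈⟨ expansion-agrees ρ (d p) d-uses ⟩
      Sat expansion ρ (d p)
        ∎

DefExt-expansion : ∀ {T⁺ T} → DefExt T⁺ T → ∀ M → M ⊨ᵀ T →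
                   Σ Structure λ N → N ⊨ᵀ T⁺ × (∀ φ → Uses (sig T) φ → M ⊨ φ ⇔ N ⊨ φ)
DefExt-expansion {T⁺} {T} (_ , d , d-defining , models) M M⊨T =
  expansion , proj₂ (models expansion) (expansion⊨T , defines) , expansion-agrees _
  where
  open Expansion (sig T) d M
  expansion⊨T : expansion ⊨ᵀ T
  expansion⊨T φ φ∈T = to (expansion-agrees _ φ (proj₂ (wf T φ φ∈T))) (M⊨T φ φ∈T)
  defines : ∀ p → sig T⁺ p → ¬ sig T p → expansion ⊨ explicitDef p (d p)
  defines p p∈T⁺ p∉T = expansion-defines p (d-defining p p∈T⁺ p∉T) p∉T

DefMergeable-⊨ᵀ : ∀ {T₁ T₂} → DefMergeable T₁ T₂ → sig T₂ ⊆ˢ sig T₁ → ∀ M → M ⊨ᵀ T₁ → M ⊨ᵀ T₂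
DefMergeable-⊨ᵀ {T₁} {T₂} (T⁺ , ext₁ , (_ , _ , _ , models₂)) L₂⊆L₁ M M⊨T₁ φ φ∈T₂
  with DefExt-expansion {T⁺} {T₁} ext₁ M M⊨T₁
... | N , N⊨T⁺ , M≈N =
  from (M≈N φ (Uses-mono L₂⊆L₁ φ (proj₂ (wf T₂ φ φ∈T₂)))) (proj₁ (proj₁ (models₂ N) N⊨T⁺) φ φ∈T₂)

_∪ᵀ_ : Theory → Theory → Theory
T ∪ᵀ U = record
  { sig = λ s → sig T s ⊎ sig U s
  ; ax  = λ φ → ax T φ ⊎ ax U φ
  ; wf  = λ where
      φ (inj₁ φ∈T) → map₂ (Uses-mono (λ _ → inj₁) φ) (wf T φ φ∈T)
      φ (inj₂ φ∈U) → map₂ (Uses-mono (λ _ → inj₂) φ) (wf U φ φ∈U)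
  }

⊨ᵀ-∪ᵀ-comm : ∀ {M T U} → M ⊨ᵀ (T ∪ᵀ U) → M ⊨ᵀ (U ∪ᵀ T)
⊨ᵀ-∪ᵀ-comm M⊨T∪U φ = M⊨T∪U φ ∘ swap

DefExt-∪ᵀ-comm : ∀ {T U V} → DefExt (T ∪ᵀ U) V → DefExt (U ∪ᵀ T) V
DefExt-∪ᵀ-comm {T} {U} (V⊆T∪U , d , d-defining , models) =
  (λ s → swap ∘ V⊆T∪U s) , d , (λ p → d-defining p ∘ swap) , λ M →
    (λ M⊨U∪T → map₂ (λ defs p → defs p ∘ swap)
                      (proj₁ (models M) (⊨ᵀ-∪ᵀ-comm {M} {U} {T} M⊨U∪T)))
  , (λ (M⊨V , defs) → ⊨ᵀ-∪ᵀ-comm {M} {T} {U} (proj₂ (models M) (M⊨V , λ p → defs p ∘ swap)))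

literal : Bool → Formula → Formula
literal true  φ = φ
literal false φ = neg φ

truthValue : Bool → Formula
truthValue b = literal b (eq 0 0)

everywhere : ℕ → Bool → Formula
everywhere k b = all 0 (literal b (rel (k , 1) (0 ∷ [])))

Free-literal : ∀ {x} b φ → Free x (literal b φ) → Free x φ
Free-literal true  φ x∈φ         = x∈φ
Free-literal false φ (f-neg x∈φ) = x∈φ

Uses-literal : ∀ {L} b φ → Uses L φ → Uses L (literal b φ)
Uses-literal true  φ u = u
Uses-literal false φ u = u

truthValue-bound : ∀ b x → Free x (truthValue b) → x < 1
truthValue-bound b x x∈b with Free-literal b (eq 0 0) x∈b
... | f-eqˡ = s≤s z≤n
... | f-eqʳ = s≤s z≤n

everywhere-sentence : ∀ k b → Sentence (everywhere k b)
everywhere-sentence k b x (f-all x≢0 x∈φ) with Free-literal b _ x∈φ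
... | f-rel here = x≢0 refl

Sat-literal : ∀ M ρ b φ → Sat M ρ (literal b φ) ⇔ (Sat M ρ φ ⇔ Sat M ρ (truthValue b))
Sat-literal M ρ true  φ = mk⇔ (λ s → mk⇔ (λ _ k → k refl) (λ _ → s)) (λ φ⇔⊤ → from φ⇔⊤ (λ k → k refl))
Sat-literal M ρ false φ =
  mk⇔ (λ ¬s → mk⇔ (λ s → contradiction s ¬s) (contradiction (λ k → k refl)))
      (λ φ⇔⊥ s → to φ⇔⊥ s (λ k → k refl))

everywhere⇔explicitDef : ∀ M k b → M ⊨ everywhere k b ⇔ M ⊨ explicitDef (k , 1) (truthValue b)
everywhere⇔explicitDef M k b = Π-cong-⇔ λ a →
  ⇔-sym (Sat-iff M _ (rel (k , 1) (0 ∷ [])) (truthValue b)) ⇔-∘ Sat-literal M _ b (rel (k , 1) (0 ∷ []))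

Everywhere : ℕ → Bool → Theory
Everywhere k b = record
  { sig = _≡ (k , 1)
  ; ax  = _≡ everywhere k b
  ; wf  = λ { _ refl → everywhere-sentence k b , Uses-literal b (rel (k , 1) (0 ∷ [])) refl }
  }

∪ᵀ-Everywhere-DefExt : ∀ T k b → ¬ sig T (k , 1) → DefExt (T ∪ᵀ Everywhere k b) T
∪ᵀ-Everywhere-DefExt T k b k∉T = (λ _ → inj₁) , (λ _ → truthValue b) , defining , λ M →
      (λ M⊨T∪E → (λ φ → M⊨T∪E φ ∘ inj₁) , λ where
         p (inj₁ p∈T) p∉T → contradiction p∈T p∉T
         _ (inj₂ refl) _  → to (everywhere⇔explicitDef M k b) (M⊨T∪E _ (inj₂ refl)))
    , (λ (M⊨T , defs) → λ where
         φ (inj₁ φ∈T)  → M⊨T φ φ∈T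
         _ (inj₂ refl) → from (everywhere⇔explicitDef M k b) (defs _ (inj₂ refl) k∉T))
  where
  defining : ∀ p → sig (T ∪ᵀ Everywhere k b) p → ¬ sig T p → DefiningFormula (sig T) p (truthValue b)
  defining p (inj₁ p∈T) p∉T = contradiction p∈T p∉T
  defining _ (inj₂ refl) _  = Uses-literal b (eq 0 0) tt , truthValue-bound b

DefMergeable-Everywhere : ∀ {k l} b c → ¬ k ≡ l → DefMergeable (Everywhere k b) (Everywhere l c)
DefMergeable-Everywhere {k} {l} b c k≢l =
    Everywhere k b ∪ᵀ Everywhere l c
  , ∪ᵀ-Everywhere-DefExt (Everywhere k b) l c (k≢l ∘ sym ∘ cong proj₁)
  , DefExt-∪ᵀ-comm {Everywhere l c} {Everywhere k b} {Everywhere l c}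
      (∪ᵀ-Everywhere-DefExt (Everywhere l c) k b (k≢l ∘ cong proj₁))

allTrue : Structure
allTrue = record { Carrier = ⊤ ; point = tt ; interp = λ _ _ → ⊤ }

¬DefMergeable-Everywhere : ∀ k → ¬ DefMergeable (Everywhere k true) (Everywhere k false)
¬DefMergeable-Everywhere k merge =
  DefMergeable-⊨ᵀ {Everywhere k true} {Everywhere k false} merge (λ _ → id)
    allTrue (λ { _ refl _ ¬⊤ → ¬⊤ tt }) _ refl tt (λ ¬⊤ → ¬⊤ tt)

theorem1 : Σ Theory λ T₁ → Σ Theory λ T₂ → Σ Theory λ T₃ → DefMergeable T₁ T₃ × DefMergeable T₃ T₂ × ¬ DefMergeable T₁ T₂
theorem1 =
    Everywhere 0 true , Everywhere 0 false , Everywhere 1 true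
  , DefMergeable-Everywhere true true (λ ())
  , DefMergeable-Everywhere true false (λ ())
  , ¬DefMergeable-Everywhere 0
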